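{- Let $\mathcal{R}=[r_{i,j}]$, $i\ge 0$, $j\in\mathbb{Z}$, be the Pascal rhombus, defined by $r_{0,0}=r_{1,-1}=r_{1,0}=r_{1,1}=1$, $r_{0,j}=0$ for $j\neq 0$, $r_{1,j}=0$ for $j\notin\{ -1,0,1\}$, and $r_{i,j}=r_{i-1,j-1}+r_{i-1,j}+r_{i-1,j+1}+r_{i-2,j}$ for $i\ge 2$, $j\in\mathbb{Z}$. Then for integers $0\le j\le i$, $$r_{i,j}=\sum_{m=0}^{\lfloor\frac{i-j}{2}\rfloor}\binom{2m+j}{m}F_{i-j-2m+1}^{(j+2m+1)},$$ where $F^{(r)}_l$ are the convolved Fibonacci numbers.
   Context: For a positive integer $r$, the convolved Fibonacci numbers $F^{(r)}_{k}$ ($k\ge 1$) are defined by $(1-x-x^2)^{ -r}=\sum_{k=0}^{\infty}F_{k+1}^{(r)}x^k$. -}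

module Defs where

open import Data.Nat using (ℕ; zero; suc; _∸_)
open import Data.Integer as ℤ using (ℤ; +_; -[1+_]; 0ℤ; 1ℤ)
open import Data.List using (List; []; _∷_; reverse; _++_; [_]; length)
open import Data.Maybe using (Maybe; just; nothing)

rhombus : ℕ → ℤ → ℕ
rhombus zero (+ zero) = 1
rhombus zero _ = 0
rhombus (suc zero) (+ zero) = 1
rhombus (suc zero) (+ suc zero) = 1
rhombus (suc zero) -[1+ zero ] = 1
rhombus (suc zero) _ = 0
rhombus (suc (suc i)) j =
  Data.Nat._+_ (Data.Nat._+_ (Data.Nat._+_ (rhombus (suc i) (j ℤ.- 1ℤ)) (rhombus (suc i) j))
                             (rhombus (suc i) (j ℤ.+ 1ℤ)))
               (rhombus i j)

Series : Set
Series = ℕ → ℤ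

sumTo : ℕ → (ℕ → ℤ) → ℤ
sumTo zero f = f zero
sumTo (suc n) f = sumTo n f ℤ.+ f (suc n)

_⊛_ : Series → Series → Series
(a ⊛ b) n = sumTo n (λ k → a k ℤ.* b (n ∸ k))

oneS : Series
oneS zero = 1ℤ
oneS (suc _) = 0ℤ

_^S_ : Series → ℕ → Series
s ^S zero = oneS
s ^S suc r = s ⊛ (s ^S r)

fibDen : Series
fibDen zero = 1ℤ
fibDen (suc zero) = ℤ.- 1ℤ
fibDen (suc (suc zero)) = ℤ.- 1ℤ
fibDen (suc (suc (suc _))) = 0ℤ

-- Multiplicative inverse of a series a with a 0 = 1:
-- b 0 = 1,  b n = - Σ_{i=1}^{n} a i * b (n - i).
-- invList a n = [b n, b (n-1), ..., b 0]
lookupL : List ℤ → ℕ → ℤ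
lookupL [] _ = 0ℤ
lookupL (x ∷ xs) zero = x
lookupL (x ∷ xs) (suc k) = lookupL xs k

invList : Series → ℕ → List ℤ
invList a zero = 1ℤ ∷ []
invList a (suc n) =
  let prev = invList a n
      -- b (suc n - i) for i ≥ 1 is  lookupL prev (i - 1)
  in ℤ.- sumTo n (λ k → a (suc k) ℤ.* lookupL prev k) ∷ prev

invS : Series → Series
invS a n = lookupL (invList a n) 0

-- Convolved Fibonacci numbers:
-- (1 - x - x²)^{-r} = Σ_{k ≥ 0} F^{(r)}_{k+1} x^k.
-- convFib r l = F^{(r)}_l for l ≥ 1 (value at l = 0 is unused, set to 0).
convFib : ℕ → ℕ → ℤ
convFib r zero = 0ℤ
convFib r (suc k) = (invS fibDen ^S r) k

module Submission where

-- With P = 1/(1 - x - x²), the bivariate generating function of the rhombus is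
--   1 / (1 - x(y + 1 + y⁻¹) - x²) = Σ_n xⁿ (y + y⁻¹)ⁿ P^{n+1},
-- so r_{i,j} = Σ_{n ≤ i} w(n,j) · [xⁱ] xⁿ P^{n+1}, where w(n,j) = [yʲ] (y + y⁻¹)ⁿ is the
-- number of ±1-walks of length n from 0 to j.  Instead of bivariate series we prove this
-- identity by induction on i: the right-hand side obeys the rhombus recurrence because
-- (1 - x - x²) P = 1 (coefficientwise: [x^{k+2}] P·s = [x^{k+1}] P·s + [x^k] P·s + [x^{k+2}] s)
-- and w(n+1,j) = w(n,j-1) + w(n,j+1).  Finally w(n,j) = C(n, (n-j)/2) when n ≥ j has the
-- parity of j and vanishes otherwise, so only n = j + 2m survives, contributing
-- C(j+2m, m) · [x^{i-j-2m}] P^{j+2m+1} = C(2m+j, m) · F^{(j+2m+1)}_{i-j-2m+1}.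

open import Defs
open import Data.Nat
  using (ℕ; zero; suc; _≤_; _<_; _≤′_; ≤′-refl; ≤′-step; _+_; _*_; _∸_; ⌊_/2⌋; z≤n; s≤s)
open import Data.Nat.Properties
  using (≤-refl; ≤-trans; ≤-reflexive; m≤n⇒m≤1+n; n≤1+n; n<1+n; m<n⇒m<1+n; ≤′⇒≤; ≤⇒≤′;
         *-monoʳ-≤; +-suc; +-comm; +-assoc; +-identityʳ; suc-injective; m+[n∸m]≡n;
         m+n∸n≡m; m≤n+m)
import Data.Nat.Tactic.RingSolver as ℕ-Solver
open import Data.Nat.Combinatorics using (_C_; nCn≡1; nCk+nC[k+1]≡[n+1]C[k+1])
open import Data.Integer using (ℤ; +_; -[1+_]; 0ℤ; 1ℤ; _⊖_)
  renaming (_+_ to _+ᶻ_; _*_ to _*ᶻ_; _-_ to _-ᶻ_; -_ to -ᶻ_)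
import Data.Integer.Properties as ℤP
open import Data.Integer.Tactic.RingSolver using (solve-∀)
open import Data.Sum using (_⊎_; inj₁; inj₂)
open import Relation.Binary.PropositionalEquality
  using (_≡_; refl; sym; trans; cong; cong₂; subst; module ≡-Reasoning)

sumTo-cong : ∀ n {f g : ℕ → ℤ} → (∀ k → k ≤ n → f k ≡ g k) → sumTo n f ≡ sumTo n g
sumTo-cong zero    f≡g = f≡g 0 z≤n
sumTo-cong (suc n) f≡g =
  cong₂ _+ᶻ_ (sumTo-cong n (λ k k≤n → f≡g k (m≤n⇒m≤1+n k≤n))) (f≡g (suc n) ≤-refl)

sumTo-+ : ∀ n (f g : ℕ → ℤ) → sumTo n (λ k → f k +ᶻ g k) ≡ sumTo n f +ᶻ sumTo n g
sumTo-+ zero    f g = refl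
sumTo-+ (suc n) f g =
  trans (cong (_+ᶻ (f (suc n) +ᶻ g (suc n))) (sumTo-+ n f g))
        (interchange (sumTo n f) (sumTo n g) (f (suc n)) (g (suc n)))
  where
  interchange : ∀ a b c d → (a +ᶻ b) +ᶻ (c +ᶻ d) ≡ (a +ᶻ c) +ᶻ (b +ᶻ d)
  interchange = solve-∀

sumTo-first : ∀ n (f : ℕ → ℤ) → sumTo (suc n) f ≡ f 0 +ᶻ sumTo n (λ k → f (suc k))
sumTo-first zero    f = refl
sumTo-first (suc n) f =
  trans (cong (_+ᶻ f (suc (suc n))) (sumTo-first n f)) (ℤP.+-assoc (f 0) _ _)

sumTo-tail-zero : ∀ {n m} (f : ℕ → ℤ) → n ≤′ m → (∀ k → n < k → f k ≡ 0ℤ) →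
                  sumTo m f ≡ sumTo n f
sumTo-tail-zero f ≤′-refl vanish = refl
sumTo-tail-zero {n} {suc m} f (≤′-step n≤′m) vanish =
  trans (cong₂ _+ᶻ_ (sumTo-tail-zero f n≤′m vanish) (vanish (suc m) (s≤s (≤′⇒≤ n≤′m))))
        (ℤP.+-identityʳ (sumTo n f))

sumTo-drop-prefix : ∀ j d (f : ℕ → ℤ) → (∀ k → k < j → f k ≡ 0ℤ) →
                    sumTo (j + d) f ≡ sumTo d (λ t → f (j + t))
sumTo-drop-prefix j zero f vanish =
  trans (cong (λ k → sumTo k f) (+-identityʳ j))
        (trans (only-last j vanish) (cong f (sym (+-identityʳ j))))
  where
  only-last : ∀ n → (∀ k → k < n → f k ≡ 0ℤ) → sumTo n f ≡ f n
  only-last zero    _ = refl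
  only-last (suc n) z =
    trans (cong (_+ᶻ f (suc n))
                (trans (only-last n (λ k k<n → z k (m<n⇒m<1+n k<n))) (z n (n<1+n n))))
          (ℤP.+-identityˡ (f (suc n)))
sumTo-drop-prefix j (suc d) f vanish =
  trans (cong (λ k → sumTo k f) (+-suc j d))
        (cong₂ _+ᶻ_ (sumTo-drop-prefix j d f vanish) (cong f (sym (+-suc j d))))

double-suc : ∀ m → 2 * suc m ≡ suc (suc (2 * m))
double-suc = ℕ-Solver.solve-∀

parity : ∀ d → (d ≡ 2 * ⌊ d /2⌋) ⊎ (d ≡ suc (2 * ⌊ d /2⌋))
parity zero          = inj₁ refl
parity (suc zero)    = inj₂ refl
parity (suc (suc d)) with parity d
... | inj₁ even = inj₁ (trans (cong (λ x → suc (suc x)) even) (sym (double-suc ⌊ d /2⌋)))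
... | inj₂ odd  = inj₂ (cong suc (trans (cong suc odd) (sym (double-suc ⌊ d /2⌋))))

-- Indices m ≤ ⌊d/2⌋ of the final sum satisfy 2m ≤ d, so d ∸ 2m is an honest difference.
half-bound : ∀ d m → m ≤ ⌊ d /2⌋ → 2 * m ≤ d
half-bound d m m≤half = ≤-trans (*-monoʳ-≤ 2 m≤half) (double-half≤ (parity d))
  where
  double-half≤ : (d ≡ 2 * ⌊ d /2⌋) ⊎ (d ≡ suc (2 * ⌊ d /2⌋)) → 2 * ⌊ d /2⌋ ≤ d
  double-half≤ (inj₁ even) = ≤-reflexive (sym even)
  double-half≤ (inj₂ odd)  = ≤-trans (n≤1+n _) (≤-reflexive (sym odd))

sumTo-even : ∀ d (g : ℕ → ℤ) → (∀ m → g (suc (2 * m)) ≡ 0ℤ) →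
             sumTo d g ≡ sumTo ⌊ d /2⌋ (λ m → g (2 * m))
sumTo-even d g odd-zero = by-parity (parity d)
  where
  up-to-even : ∀ m → sumTo (2 * m) g ≡ sumTo m (λ k → g (2 * k))
  up-to-odd  : ∀ m → sumTo (suc (2 * m)) g ≡ sumTo m (λ k → g (2 * k))
  up-to-even zero    = refl
  up-to-even (suc m) =
    trans (cong (λ x → sumTo x g) (double-suc m))
          (cong₂ _+ᶻ_ (up-to-odd m) (cong g (sym (double-suc m))))
  up-to-odd m =
    trans (cong (sumTo (2 * m) g +ᶻ_) (odd-zero m)) (trans (ℤP.+-identityʳ _) (up-to-even m))
  by-parity : (d ≡ 2 * ⌊ d /2⌋) ⊎ (d ≡ suc (2 * ⌊ d /2⌋)) →
              sumTo d g ≡ sumTo ⌊ d /2⌋ (λ m → g (2 * m))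
  by-parity (inj₁ even) = trans (cong (λ x → sumTo x g) even) (up-to-even ⌊ d /2⌋)
  by-parity (inj₂ odd)  = trans (cong (λ x → sumTo x g) odd) (up-to-odd ⌊ d /2⌋)

P : Series
P = invS fibDen

-- (1 - x - x²) P = 1 read off at x^{k+2}: the coefficients of P obey the Fibonacci rule.
P-fib : ∀ k → P (suc (suc k)) ≡ P (suc k) +ᶻ P k
P-fib k =
  trans (cong -ᶻ_ (sumTo-tail-zero {1} {suc k} terms (≤⇒≤′ (s≤s z≤n)) beyond-x²))
        (negate (P (suc k)) (P k))
  where
  terms : ℕ → ℤ
  terms t = fibDen (suc t) *ᶻ lookupL (invList fibDen (suc k)) t
  beyond-x² : ∀ t → 1 < t → terms t ≡ 0ℤ
  beyond-x² (suc zero)    (s≤s ())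
  beyond-x² (suc (suc t)) _ = ℤP.*-zeroˡ (lookupL (invList fibDen (suc k)) (2 + t))
  negate : ∀ a b → -ᶻ ((-ᶻ 1ℤ) *ᶻ a +ᶻ (-ᶻ 1ℤ) *ᶻ b) ≡ a +ᶻ b
  negate = solve-∀

-- (1 - x - x²) · (P · s) = s, read off at x⁰, x¹ and x^{k+2}: the coefficients of P · s
-- obey the Fibonacci rule with inhomogeneous term s.
P⊛-0 : ∀ s → (P ⊛ s) 0 ≡ s 0
P⊛-0 s = ℤP.*-identityˡ (s 0)

P⊛-1 : ∀ s → (P ⊛ s) 1 ≡ (P ⊛ s) 0 +ᶻ s 1
P⊛-1 s = reorder (s 1) (s 0)
  where
  reorder : ∀ a b → 1ℤ *ᶻ a +ᶻ 1ℤ *ᶻ b ≡ 1ℤ *ᶻ b +ᶻ a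
  reorder = solve-∀

P⊛-rec : ∀ s k → (P ⊛ s) (suc (suc k)) ≡ (P ⊛ s) (suc k) +ᶻ (P ⊛ s) k +ᶻ s (suc (suc k))
P⊛-rec s k = begin
    (P ⊛ s) (suc (suc k))
  ≡⟨ sumTo-first (suc k) _ ⟩
    P 0 *ᶻ s (2 + k) +ᶻ sumTo (suc k) (λ a → P (suc a) *ᶻ s (suc k ∸ a))
  ≡⟨ cong (P 0 *ᶻ s (2 + k) +ᶻ_) (sumTo-first k _) ⟩
    P 0 *ᶻ s (2 + k) +ᶻ (P 1 *ᶻ s (suc k) +ᶻ sumTo k (λ a → P (2 + a) *ᶻ s (k ∸ a)))
  ≡⟨ cong (λ z → P 0 *ᶻ s (2 + k) +ᶻ (P 1 *ᶻ s (suc k) +ᶻ z)) fibonacci-split ⟩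
    P 0 *ᶻ s (2 + k) +ᶻ (P 1 *ᶻ s (suc k) +ᶻ (tailSum +ᶻ (P ⊛ s) k))
  ≡⟨ reorder (s (2 + k)) (s (suc k)) tailSum ((P ⊛ s) k) ⟩
    (P 0 *ᶻ s (suc k) +ᶻ tailSum) +ᶻ (P ⊛ s) k +ᶻ s (2 + k)
  ≡⟨ cong (λ z → z +ᶻ (P ⊛ s) k +ᶻ s (2 + k)) (sym (sumTo-first k _)) ⟩
    (P ⊛ s) (suc k) +ᶻ (P ⊛ s) k +ᶻ s (suc (suc k))
  ∎
  where
  open ≡-Reasoning
  tailSum : ℤ
  tailSum = sumTo k (λ a → P (suc a) *ᶻ s (k ∸ a))
  fibonacci-split : sumTo k (λ a → P (2 + a) *ᶻ s (k ∸ a)) ≡ tailSum +ᶻ (P ⊛ s) k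
  fibonacci-split =
    trans (sumTo-cong k (λ a _ → trans (cong (_*ᶻ s (k ∸ a)) (P-fib a))
                                       (ℤP.*-distribʳ-+ (s (k ∸ a)) (P (suc a)) (P a))))
          (sumTo-+ k _ _)
  reorder : ∀ a b c d → 1ℤ *ᶻ a +ᶻ (1ℤ *ᶻ b +ᶻ (c +ᶻ d)) ≡ (1ℤ *ᶻ b +ᶻ c) +ᶻ d +ᶻ a
  reorder = solve-∀

shift : ℕ → Series → Series
shift zero    s k       = s k
shift (suc n) s zero    = 0ℤ
shift (suc n) s (suc k) = shift n s k

shift-below : ∀ n s k → k < n → shift n s k ≡ 0ℤ
shift-below (suc n) s zero    _         = refl
shift-below (suc n) s (suc k) (s≤s k<n) = shift-below n s k k<n

shift-at : ∀ n s e → shift n s (n + e) ≡ s e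
shift-at zero    s e = refl
shift-at (suc n) s e = shift-at n s e

shift-P⊛-1 : ∀ n s → shift n (P ⊛ s) 1 ≡ shift n (P ⊛ s) 0 +ᶻ shift n s 1
shift-P⊛-1 zero          s = P⊛-1 s
shift-P⊛-1 (suc zero)    s = trans (P⊛-0 s) (sym (ℤP.+-identityˡ (s 0)))
shift-P⊛-1 (suc (suc n)) s = refl

shift-P⊛-rec : ∀ n s k →
  shift n (P ⊛ s) (suc (suc k))
    ≡ shift n (P ⊛ s) (suc k) +ᶻ shift n (P ⊛ s) k +ᶻ shift n s (suc (suc k))
shift-P⊛-rec zero    s k       = P⊛-rec s k
shift-P⊛-rec (suc n) s zero    =
  trans (shift-P⊛-1 n s) (cong (_+ᶻ shift n s 1) (sym (ℤP.+-identityʳ (shift n (P ⊛ s) 0))))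
shift-P⊛-rec (suc n) s (suc k) = shift-P⊛-rec n s k

walks : ℕ → ℤ → ℤ
walks zero    (+ zero) = 1ℤ
walks zero    _        = 0ℤ
walks (suc n) z        = walks n (z -ᶻ 1ℤ) +ᶻ walks n (z +ᶻ 1ℤ)

walks-step : ∀ n a b → walks (suc n) (a ⊖ b) ≡ walks n (a ⊖ suc b) +ᶻ walks n (suc a ⊖ b)
walks-step n a b = cong₂ _+ᶻ_ (cong (walks n) step-down) (cong (walks n) step-up)
  where
  step-down : (a ⊖ b) -ᶻ 1ℤ ≡ a ⊖ suc b
  step-down = trans (cong (_-ᶻ 1ℤ) (sym (ℤP.m-n≡m⊖n a b)))
                    (trans (rearrange (+ a) (+ b)) (ℤP.m-n≡m⊖n a (suc b)))
    where
    rearrange : ∀ x y → (x -ᶻ y) -ᶻ 1ℤ ≡ x -ᶻ (1ℤ +ᶻ y)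
    rearrange = solve-∀
  step-up : (a ⊖ b) +ᶻ 1ℤ ≡ suc a ⊖ b
  step-up = trans (cong (_+ᶻ 1ℤ) (sym (ℤP.m-n≡m⊖n a b)))
                  (trans (rearrange (+ a) (+ b)) (ℤP.m-n≡m⊖n (suc a) b))
    where
    rearrange : ∀ x y → (x -ᶻ y) +ᶻ 1ℤ ≡ (1ℤ +ᶻ x) -ᶻ y
    rearrange = solve-∀

walks-above : ∀ n t → walks n (+ suc (n + t)) ≡ 0ℤ
walks-above zero    t = refl
walks-above (suc n) t =
  cong₂ _+ᶻ_ (walks-above n t)
             (trans (cong (λ k → walks n (+ k)) (index n t)) (walks-above n (2 + t)))
  where
  index : ∀ n t → suc (suc (n + t)) + 1 ≡ suc (n + suc (suc t))
  index = ℕ-Solver.solve-∀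

walks-below : ∀ n t → walks n -[1+ n + t ] ≡ 0ℤ
walks-below zero    t = refl
walks-below (suc n) t =
  cong₂ _+ᶻ_ (trans (cong (λ k → walks n -[1+ k ]) (index n t)) (walks-below n (2 + t)))
             (walks-below n t)
  where
  index : ∀ n t → suc (suc (n + t) + 0) ≡ n + suc (suc t)
  index = ℕ-Solver.solve-∀

-- With a up-steps and b down-steps the walk ends at a - b; there are C(a+b, b) of them.
walks-binomial : ∀ n a b → a + b ≡ n → walks n (a ⊖ b) ≡ + (n C b)
walks-binomial zero    zero    zero    refl = refl
walks-binomial (suc n) (suc a) (suc b) eq =
  trans (walks-step n (suc a) (suc b))
    (trans (cong₂ _+ᶻ_
             (trans (cong (walks n) (ℤP.[1+m]⊖[1+n]≡m⊖n a (suc b)))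
                    (walks-binomial n a (suc b) (suc-injective eq)))
             (trans (cong (walks n) (ℤP.[1+m]⊖[1+n]≡m⊖n (suc a) b))
                    (walks-binomial n (suc a) b (trans (sym (+-suc a b)) (suc-injective eq)))))
           (cong +_ (trans (+-comm (n C suc b) (n C b)) (nCk+nC[k+1]≡[n+1]C[k+1] n b))))
walks-binomial (suc n) (suc a) zero eq =
  trans (walks-step n (suc a) zero)
    (trans (cong₂ _+ᶻ_
             (trans (cong (walks n) (ℤP.[1+m]⊖[1+n]≡m⊖n a 0))
                    (walks-binomial n a 0 (suc-injective eq)))
             (trans (cong (λ k → walks n (+ suc (suc k))) a≡n)
                    (trans (cong (λ k → walks n (+ suc k)) (+-comm 1 n)) (walks-above n 1))))
           (ℤP.+-identityʳ _))
  where
  a≡n : a ≡ n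
  a≡n = trans (sym (+-identityʳ a)) (suc-injective eq)
walks-binomial (suc n) zero (suc b) eq =
  trans (walks-step n zero (suc b))
    (trans (cong₂ _+ᶻ_
             (trans (cong (λ k → walks n -[1+ suc k ]) b≡n)
                    (trans (cong (λ k → walks n -[1+ k ]) (+-comm 1 n)) (walks-below n 1)))
             (trans (cong (walks n) (ℤP.[1+m]⊖[1+n]≡m⊖n 0 b))
                    (walks-binomial n 0 b (suc-injective eq))))
           (trans (ℤP.+-identityˡ _)
                  (cong +_ (subst (λ k → n C k ≡ suc n C suc k) (sym b≡n)
                                  (trans (nCn≡1 n) (sym (nCn≡1 (suc n))))))))
  where
  b≡n : b ≡ n
  b≡n = suc-injective eq

-- A walk of length a + b + 1 cannot end at a - b: length and endpoint have equal parity.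
walks-parity : ∀ n a b → suc (a + b) ≡ n → walks n (a ⊖ b) ≡ 0ℤ
walks-parity (suc n) a b eq =
  trans (walks-step n a b) (cong₂ _+ᶻ_ (last-step-up a b eq) (last-step-down a b eq))
  where
  last-step-up : ∀ a b → suc (a + b) ≡ suc n → walks n (a ⊖ suc b) ≡ 0ℤ
  last-step-up zero    b eq =
    trans (cong (λ k → walks n -[1+ k ]) (trans (suc-injective eq) (sym (+-identityʳ n))))
          (walks-below n 0)
  last-step-up (suc a) b eq =
    trans (cong (walks n) (ℤP.[1+m]⊖[1+n]≡m⊖n a b)) (walks-parity n a b (suc-injective eq))
  last-step-down : ∀ a b → suc (a + b) ≡ suc n → walks n (suc a ⊖ b) ≡ 0ℤ
  last-step-down a zero    eq =
    trans (cong (λ k → walks n (+ suc k))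
                (trans (trans (sym (+-identityʳ a)) (suc-injective eq)) (sym (+-identityʳ n))))
          (walks-above n 0)
  last-step-down a (suc b) eq =
    trans (cong (walks n) (ℤP.[1+m]⊖[1+n]≡m⊖n a b))
          (walks-parity n a b (trans (sym (+-suc a b)) (suc-injective eq)))

fibTerm : ℕ → ℕ → ℤ
fibTerm n = shift n (P ^S suc n)

expansion : ℕ → ℤ → ℤ
expansion i j = sumTo i (λ n → walks n j *ᶻ fibTerm n i)

-- Summands with n > i vanish, so the range of summation may be extended freely.
expansion-extend : ∀ {i m} j → i ≤′ m → sumTo m (λ n → walks n j *ᶻ fibTerm n i) ≡ expansion i j
expansion-extend {i} j i≤′m = sumTo-tail-zero _ i≤′m vanish
  where
  vanish : ∀ n → i < n → walks n j *ᶻ fibTerm n i ≡ 0ℤ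
  vanish n i<n = trans (cong (walks n j *ᶻ_) (shift-below n (P ^S suc n) i i<n))
                       (ℤP.*-zeroʳ (walks n j))

-- The inhomogeneous part of the recurrence (one power of P less, from shift-P⊛-rec) is,
-- after splitting off the last step of each walk, the previous row at j ∓ 1; the n = 0
-- summand vanishes since P⁰ = 1 has no coefficient at x^{i+2}.
expansion-lower : ∀ i j →
  sumTo (2 + i) (λ n → walks n j *ᶻ shift n (P ^S n) (2 + i))
    ≡ expansion (suc i) (j -ᶻ 1ℤ) +ᶻ expansion (suc i) (j +ᶻ 1ℤ)
expansion-lower i j =
  trans (sumTo-first (suc i) _)
    (trans (cong₂ _+ᶻ_ (ℤP.*-zeroʳ (walks 0 j)) last-step)
           (ℤP.+-identityˡ _))
  where
  last-step : sumTo (suc i) (λ n → walks (suc n) j *ᶻ fibTerm n (suc i))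
                ≡ expansion (suc i) (j -ᶻ 1ℤ) +ᶻ expansion (suc i) (j +ᶻ 1ℤ)
  last-step =
    trans (sumTo-cong (suc i) (λ n _ → ℤP.*-distribʳ-+ (fibTerm n (suc i))
                                                        (walks n (j -ᶻ 1ℤ)) (walks n (j +ᶻ 1ℤ))))
          (sumTo-+ (suc i) _ _)

expansion-rec : ∀ i j →
  expansion (2 + i) j
    ≡ expansion (suc i) (j -ᶻ 1ℤ) +ᶻ expansion (suc i) j +ᶻ expansion (suc i) (j +ᶻ 1ℤ)
      +ᶻ expansion i j
expansion-rec i j = begin
    expansion (2 + i) j
  ≡⟨ sumTo-cong (2 + i) (λ n _ → trans (cong (walks n j *ᶻ_) (shift-P⊛-rec n (P ^S n) i))
                                        (distrib (walks n j) _ _ _)) ⟩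
    sumTo (2 + i) (λ n → walks n j *ᶻ fibTerm n (suc i) +ᶻ walks n j *ᶻ fibTerm n i
                           +ᶻ walks n j *ᶻ shift n (P ^S n) (2 + i))
  ≡⟨ trans (sumTo-+ (2 + i) _ _) (cong (_+ᶻ lower) (sumTo-+ (2 + i) _ _)) ⟩
    sumTo (2 + i) (λ n → walks n j *ᶻ fibTerm n (suc i))
      +ᶻ sumTo (2 + i) (λ n → walks n j *ᶻ fibTerm n i) +ᶻ lower
  ≡⟨ cong₂ (λ a b → a +ᶻ b +ᶻ lower)
           (expansion-extend {suc i} {2 + i} j (≤′-step ≤′-refl))
           (expansion-extend {i} {2 + i} j (≤′-step (≤′-step ≤′-refl))) ⟩
    above j +ᶻ twoAbove +ᶻ lower
  ≡⟨ cong (above j +ᶻ twoAbove +ᶻ_) (expansion-lower i j) ⟩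
    above j +ᶻ twoAbove +ᶻ (above (j -ᶻ 1ℤ) +ᶻ above (j +ᶻ 1ℤ))
  ≡⟨ reorder (above j) twoAbove (above (j -ᶻ 1ℤ)) (above (j +ᶻ 1ℤ)) ⟩
    above (j -ᶻ 1ℤ) +ᶻ above j +ᶻ above (j +ᶻ 1ℤ) +ᶻ twoAbove
  ∎
  where
  open ≡-Reasoning
  above : ℤ → ℤ
  above = expansion (suc i)
  twoAbove : ℤ
  twoAbove = expansion i j
  lower : ℤ
  lower = sumTo (2 + i) (λ n → walks n j *ᶻ shift n (P ^S n) (2 + i))
  distrib : ∀ w a b c → w *ᶻ (a +ᶻ b +ᶻ c) ≡ w *ᶻ a +ᶻ w *ᶻ b +ᶻ w *ᶻ c
  distrib = solve-∀
  reorder : ∀ a b x y → a +ᶻ b +ᶻ (x +ᶻ y) ≡ x +ᶻ a +ᶻ y +ᶻ b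
  reorder = solve-∀

-- Both sides agree on the first two rows and obey the same recurrence.
rhombus≡expansion : ∀ i j → + rhombus i j ≡ expansion i j
rhombus≡expansion zero          (+ zero)          = refl
rhombus≡expansion zero          (+ suc n)         = refl
rhombus≡expansion zero          -[1+ n ]          = refl
rhombus≡expansion (suc zero)    (+ zero)          = refl
rhombus≡expansion (suc zero)    (+ suc zero)      = refl
rhombus≡expansion (suc zero)    (+ suc (suc n))   = refl
rhombus≡expansion (suc zero)    -[1+ zero ]       = refl
rhombus≡expansion (suc zero)    -[1+ suc n ]      = refl
rhombus≡expansion (suc (suc i)) j =
  trans (cong₂ _+ᶻ_ (cong₂ _+ᶻ_ (cong₂ _+ᶻ_ (rhombus≡expansion (suc i) (j -ᶻ 1ℤ))
                                            (rhombus≡expansion (suc i) j))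
                               (rhombus≡expansion (suc i) (j +ᶻ 1ℤ)))
                    (rhombus≡expansion i j))
        (sym (expansion-rec i j))

walks-short : ∀ n j → n < j → walks n (+ j) ≡ 0ℤ
walks-short n j n<j = trans (cong (λ k → walks n (+ k)) (sym (m+[n∸m]≡n n<j)))
                            (walks-above n (j ∸ suc n))

j+m⊖m : ∀ j m → (j + m) ⊖ m ≡ + j
j+m⊖m j m = trans (ℤP.⊖-≥ (m≤n+m m j)) (cong +_ (m+n∸n≡m j m))

walks-odd : ∀ j m → walks (j + suc (2 * m)) (+ j) ≡ 0ℤ
walks-odd j m = trans (cong (walks (j + suc (2 * m))) (sym (j+m⊖m j m)))
                      (walks-parity (j + suc (2 * m)) (j + m) m (length j m))
  where
  length : ∀ j m → suc (j + m + m) ≡ j + suc (2 * m)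
  length = ℕ-Solver.solve-∀

walks-even : ∀ j m → walks (j + 2 * m) (+ j) ≡ + ((2 * m + j) C m)
walks-even j m =
  trans (cong (walks (j + 2 * m)) (sym (j+m⊖m j m)))
    (trans (walks-binomial (j + 2 * m) (j + m) m (length j m))
           (cong (λ k → + (k C m)) (+-comm j (2 * m))))
  where
  length : ∀ j m → j + m + m ≡ j + 2 * m
  length = ℕ-Solver.solve-∀

fibTerm-convFib : ∀ n e → fibTerm n (n + e) ≡ convFib (n + 1) (e + 1)
fibTerm-convFib n e =
  trans (shift-at n (P ^S suc n) e) (sym (cong₂ convFib (+-comm n 1) (+-comm e 1)))

expansion-closed-form : ∀ j d →
  expansion (j + d) (+ j)
    ≡ sumTo ⌊ d /2⌋ (λ m → + ((2 * m + j) C m) *ᶻ convFib (j + 2 * m + 1) (d ∸ 2 * m + 1))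
expansion-closed-form j d =
  trans (sumTo-drop-prefix j d summand short)
    (trans (sumTo-even d (λ t → summand (j + t)) odd)
           (sumTo-cong ⌊ d /2⌋ even))
  where
  summand : ℕ → ℤ
  summand n = walks n (+ j) *ᶻ fibTerm n (j + d)
  short : ∀ n → n < j → summand n ≡ 0ℤ
  short n n<j = trans (cong (_*ᶻ fibTerm n (j + d)) (walks-short n j n<j))
                      (ℤP.*-zeroˡ (fibTerm n (j + d)))
  odd : ∀ m → summand (j + suc (2 * m)) ≡ 0ℤ
  odd m = trans (cong (_*ᶻ fibTerm (j + suc (2 * m)) (j + d)) (walks-odd j m))
                (ℤP.*-zeroˡ (fibTerm (j + suc (2 * m)) (j + d)))
  row : ∀ m → m ≤ ⌊ d /2⌋ → j + d ≡ (j + 2 * m) + (d ∸ 2 * m)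
  row m m≤half = trans (cong (λ x → j + x) (sym (m+[n∸m]≡n (half-bound d m m≤half))))
                       (sym (+-assoc j (2 * m) (d ∸ 2 * m)))
  even : ∀ m → m ≤ ⌊ d /2⌋ →
         summand (j + 2 * m) ≡ + ((2 * m + j) C m) *ᶻ convFib (j + 2 * m + 1) (d ∸ 2 * m + 1)
  even m m≤half =
    cong₂ _*ᶻ_ (walks-even j m)
               (trans (cong (fibTerm (j + 2 * m)) (row m m≤half))
                      (fibTerm-convFib (j + 2 * m) (d ∸ 2 * m)))

corollary2p5 : (i j : ℕ) → j ≤ i →
    + rhombus i (+ j)
      ≡ sumTo ⌊ (i ∸ j) /2⌋
          (λ m → + ((2 * m + j) C m) Data.Integer.* convFib (j + 2 * m + 1) (i ∸ j ∸ 2 * m + 1))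
corollary2p5 i j j≤i = begin
    + rhombus i (+ j)
  ≡⟨ rhombus≡expansion i (+ j) ⟩
    expansion i (+ j)
  ≡⟨ cong (λ k → expansion k (+ j)) (sym (m+[n∸m]≡n j≤i)) ⟩
    expansion (j + (i ∸ j)) (+ j)
  ≡⟨ expansion-closed-form j (i ∸ j) ⟩
    sumTo ⌊ (i ∸ j) /2⌋ (λ m → + ((2 * m + j) C m) *ᶻ convFib (j + 2 * m + 1) (i ∸ j ∸ 2 * m + 1))
  ∎
  where open ≡-Reasoning
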